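{- For every $n\ge1$, the lattice of flats $L(W^n)$ of the whirl matroid $W^n$ is the disjoint union of $L_1(W^n)$ and $L_2(W^n)$, where for $n\ge3$ \[ L_1(W^n)=\{O_n\setminus\{e\} : e\in O_n\},\qquad L_2(W^n)=\{E(W_n)\}\cup\{F\in L(M(W_n)) : O_n\not\subseteq F\}, \] with $M(W_n)$ the graphic matroid of $W_n$; for $n=1$, $L_1(W^1)=\{\emptyset\}$ and $L_2(W^1)=\{E(G)\}$ where $W^1=M(G)$ with $G$ the single-edge graph on $\{0,1\}$; and for $n=2$, $L_1(W^2)=\{\{e_1\},\{e_2\}\}$ and $L_2(W^2)=\{\emptyset,\{(0,1)\},\{(0,2)\},E\}$ with $E=\{(0,1),(0,2),e_1,e_2\}$.
   Context: For $n\ge3$ the wheel graph $W_n$ has vertex set $\{0,1,\dots,n\}$, the edges of the outer cycle $1,2,\dots,n,1$ (whose edge set is denoted $O_n$), and edges $\{0,i\}$ for $1\le i\le n$. The whirl matroid $W^n$ is the matroid on ground set $E(W_n)$ whose independent sets are the edge sets of forests of $W_n$ together with the set $O_n$. $W^1$ is the graphic matroid of the single-edge graph $G$ on $\{0,1\}$. $W^2$ is the matroid on $E=\{(0,1),(0,2),e_1,e_2\}$ obtained from the graphic matroid of the multigraph on $\{0,1,2\}$ with edges $(0,1),(0,2)$ and parallel edges $e_1,e_2$ joining $1$ and $2$, by declaring $\{e_1,e_2\}$ independent (so its independent sets are all subsets of size at most $2$). $L(M)$ denotes the set of flats of a matroid $M$. -}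

module Defs where

open import Data.Nat using (ℕ; zero; suc; _<_; _≤_; _+_)
open import Data.Nat.Properties using (_≟_)
open import Data.Fin using (Fin; zero; suc; toℕ; lower₁; splitAt)
open import Data.Fin.Subset using (Subset; _∈_; _∉_; _⊆_; ∣_∣; _∪_; ⁅_⁆; _-_; ⊤; ⊥)
open import Data.Bool using (Bool; true; false)
open import Data.Vec using (tabulate)
open import Data.Product using (Σ; ∃; _×_; _,_)
open import Data.Sum using (_⊎_; inj₁; inj₂)
open import Function.Definitions using (Injective)
open import Relation.Binary.PropositionalEquality using (_≡_)
open import Relation.Nullary using (¬_; yes; no)

-- Flat: adding any element outside F strictly increases the rank,
-- i.e.  r(F ∪ {e}) > r(F)  for every e ∉ F, unfolded as: there is an
-- independent subset of F ∪ {e} larger than every independent subset of F.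
IsFlat : ∀ {m} → (Subset m → Set) → Subset m → Set
IsFlat {m} Indep F =
  (e : Fin m) → e ∉ F →
  Σ (Subset m) λ I → I ⊆ (F ∪ ⁅ e ⁆) × Indep I ×
    ((J : Subset m) → J ⊆ F → Indep J → ∣ J ∣ < ∣ I ∣)

record Graph : Set where
  field
    nV   : ℕ
    nE   : ℕ
    ends : Fin nE → Fin nV × Fin nV

open Graph public

Joins : (G : Graph) → Fin (nE G) → Fin (nV G) → Fin (nV G) → Set
Joins G e u w = (ends G e ≡ (u , w)) ⊎ (ends G e ≡ (w , u))

next : ∀ {n} → Fin n → Fin n
next {suc k} i with k ≟ toℕ i
... | yes _ = zero
... | no ne = suc (lower₁ i ne)

-- A cycle in the edge set X: a closed trail v₀ e₀ v₁ e₁ … v_{k} e_{k} v₀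
-- (length k+1 ≥ 1) with pairwise distinct vertices and pairwise distinct
-- edges, all in X.  (Length 1 = loop, length 2 = pair of parallel edges.)
record Cycle (G : Graph) (X : Subset (nE G)) : Set where
  field
    len    : ℕ
    verts  : Fin (suc len) → Fin (nV G)
    edges  : Fin (suc len) → Fin (nE G)
    vinj   : Injective _≡_ _≡_ verts
    einj   : Injective _≡_ _≡_ edges
    inX    : ∀ i → edges i ∈ X
    joins  : ∀ i → Joins G (edges i) (verts i) (verts (next i))

Forest : (G : Graph) → Subset (nE G) → Set
Forest G X = ¬ Cycle G X

GraphicIndep : (G : Graph) → Subset (nE G) → Set
GraphicIndep G = Forest G

-- Wheel W_n (n ≥ 3): vertices Fin (suc n), 0 = hub, suc i = rim vertex i+1.
-- Edges Fin (n + n): the first n are rim edges {i+1, i+2 mod n},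
-- the last n are spokes {0, i+1}.

wheelEnds : (n : ℕ) → Fin (n + n) → Fin (suc n) × Fin (suc n)
wheelEnds n e with splitAt n e
... | inj₁ i = (suc i , suc (next i))
... | inj₂ i = (zero , suc i)

Wheel : ℕ → Graph
Wheel n = record { nV = suc n ; nE = n + n ; ends = wheelEnds n }

isRim : (n : ℕ) → Fin (n + n) → Bool
isRim n e with splitAt n e
... | inj₁ _ = true
... | inj₂ _ = false

Rim : (n : ℕ) → Subset (n + n)
Rim n = tabulate (isRim n)

WhirlIndep : (n : ℕ) → Subset (n + n) → Set
WhirlIndep n X = Forest (Wheel n) X ⊎ (X ≡ Rim n)

L₁ : (n : ℕ) → Subset (n + n) → Set
L₁ n F = Σ (Fin (n + n)) λ e → e ∈ Rim n × (F ≡ Rim n - e)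

L₂ : (n : ℕ) → Subset (n + n) → Set
L₂ n F = (F ≡ ⊤) ⊎ (IsFlat (GraphicIndep (Wheel n)) F × ¬ (Rim n ⊆ F))

G₁ : Graph
G₁ = record { nV = 2 ; nE = 1 ; ends = λ _ → (zero , suc zero) }

W¹Indep : Subset 1 → Set
W¹Indep = GraphicIndep G₁

L₁-W¹ : Subset 1 → Set
L₁-W¹ F = F ≡ ⊥

L₂-W¹ : Subset 1 → Set
L₂-W¹ F = F ≡ ⊤

-- n = 2 : edges 0 = (0,1), 1 = (0,2), 2 = e₁, 3 = e₂ (e₁, e₂ parallel
-- edges joining 1 and 2); W^2 is M(H) with {e₁,e₂} declared independent.

e₀₁ e₀₂ e₁ e₂ : Fin 4
e₀₁ = zero
e₀₂ = suc zero
e₁  = suc (suc zero)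
e₂  = suc (suc (suc zero))

endsH : Fin 4 → Fin 3 × Fin 3
endsH zero = (zero , suc zero)
endsH (suc zero) = (zero , suc (suc zero))
endsH (suc (suc zero)) = (suc zero , suc (suc zero))
endsH (suc (suc (suc zero))) = (suc zero , suc (suc zero))

H₂ : Graph
H₂ = record { nV = 3 ; nE = 4 ; ends = endsH }

W²Indep : Subset 4 → Set
W²Indep X = GraphicIndep H₂ X ⊎ (X ≡ ⁅ e₁ ⁆ ∪ ⁅ e₂ ⁆)

L₁-W² : Subset 4 → Set
L₁-W² F = (F ≡ ⁅ e₁ ⁆) ⊎ (F ≡ ⁅ e₂ ⁆)

L₂-W² : Subset 4 → Set
L₂-W² F = (F ≡ ⊥) ⊎ (F ≡ ⁅ e₀₁ ⁆) ⊎ (F ≡ ⁅ e₀₂ ⁆) ⊎ (F ≡ ⊤)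

DisjointUnionOfFlats : ∀ {m} → (Subset m → Set) → (Subset m → Set) → (Subset m → Set) → Set
DisjointUnionOfFlats {m} Indep A B =
  ((F : Subset m) → IsFlat Indep F → A F ⊎ B F) ×
  ((F : Subset m) → A F ⊎ B F → IsFlat Indep F) ×
  ((F : Subset m) → ¬ (A F × B F))

-- W¹ and W² are the uniform matroids U₁,₁ and U₂,₄, whose flats are the sets of size
-- below the rank together with the whole ground set.
--
-- For n ≥ 1 every forest of the wheel W_n has at most n edges: after rotating the wheel so
-- that a rim edge missing from the forest comes last, each maximal run of rim edges carries
-- at most one spoke, since two spokes joined by a run close a cycle through the hub.  So W^n
-- has rank n, and a flat containing O_n is everything.  As (O_n − e) ∪ {s} is a spanning
-- path for every rim edge e and spoke s, each O_n − e is a flat of W^n but not of M(W_n).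
-- Finally, if a flat F with O_n ⊈ F is not of this form, O_n can never witness a rank
-- increase of F, because some (O_n − e) ∪ {s} ⊆ F already has n edges; hence F is a flat
-- of M(W_n).
module Submission where

open import Defs
open import Data.Nat using (ℕ; zero; suc; _+_; _∸_; _≤_; _<_; z≤n; s≤s; s≤s⁻¹; _≤?_)
open import Data.Nat.Properties
open import Data.Nat.DivMod using (_mod_; m%n<n; m<n⇒m%n≡m)
open import Algebra.Properties.CommutativeSemigroup +-commutativeSemigroup using (interchange)
open import Data.Fin using (Fin; zero; suc; toℕ; fromℕ; inject₁; _↑ˡ_; _↑ʳ_; splitAt) renaming (_≟_ to _≟ᶠ_)
open import Data.Fin.Properties using (all?; any?; toℕ-injective; toℕ-fromℕ<; toℕ-fromℕ; toℕ<n; toℕ-lower₁; toℕ-inject₁; ¬∀⟶∃¬; ↑ˡ-injective; ↑ʳ-injective; splitAt-↑ˡ; splitAt-↑ʳ; join-splitAt) renaming (suc-injective to fsuc-injective; 0≢1+n to fzero≢fsuc)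
open import Data.Fin.Subset using (Subset; _∈_; _∉_; _⊆_; ∣_∣; _∪_; ⁅_⁆; _-_; ⊤; ⊥; inside; outside)
open import Data.Fin.Subset.Properties
open import Data.Vec using ([]; _∷_; lookup; tabulate; here; there)
open import Data.Vec.Properties using (lookup∘tabulate; tabulate∘lookup; lookup⇒[]=; []=⇒lookup) renaming (≡-dec to ≡-decᵛ)
open import Data.Bool using (Bool; true; false; _∨_; _∧_) renaming (_≟_ to _≟ᵇ_)
open import Data.Product using (_×_; Σ; ∃; _,_; proj₁; proj₂; swap)
open import Data.Product.Properties using (≡-dec)
open import Data.Empty using (⊥-elim)
open import Data.Sum using (_⊎_; inj₁; inj₂; [_,_]′)
open import Function using (_∘_; id)
open import Function.Definitions using (Injective)
open import Relation.Binary.Definitions using (DecidableEquality)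
open import Relation.Binary.PropositionalEquality using (_≡_; _≢_; refl; sym; trans; cong; cong₂; subst; module ≡-Reasoning)
open import Relation.Nullary using (¬_; Dec; yes; no; contradiction)
open import Relation.Nullary.Decidable using (decidable-stable; _→-dec_; _×-dec_; _⊎-dec_; map′; from-yes)

-- Finite sets

∣p∪⁅x⁆∣≡1+∣p∣ : ∀ {n} {p : Subset n} {x} → x ∉ p → ∣ p ∪ ⁅ x ⁆ ∣ ≡ suc ∣ p ∣
∣p∪⁅x⁆∣≡1+∣p∣ {p = true ∷ p} {zero} x∉p = contradiction here x∉p
∣p∪⁅x⁆∣≡1+∣p∣ {p = false ∷ p} {zero} _ = cong (suc ∘ ∣_∣) (∪-identityʳ p)
∣p∪⁅x⁆∣≡1+∣p∣ {p = true ∷ p} {suc x} x∉p = cong suc (∣p∪⁅x⁆∣≡1+∣p∣ (x∉p ∘ there))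
∣p∪⁅x⁆∣≡1+∣p∣ {p = false ∷ p} {suc x} x∉p = ∣p∪⁅x⁆∣≡1+∣p∣ (x∉p ∘ there)

x∉p-x : ∀ {n} (p : Subset n) x → x ∉ p - x
x∉p-x (_ ∷ p) zero ()
x∉p-x (_ ∷ p) (suc x) (there x∈p-x) = x∉p-x p x x∈p-x

x∈p-y⇒x≢y : ∀ {n} {p : Subset n} {x y} → x ∈ p - y → x ≢ y
x∈p-y⇒x≢y {p = p} {x} x∈p-x refl = x∉p-x p x x∈p-x

x∈p-y⇒x∈p : ∀ {n} {p : Subset n} {x y} → x ∈ p - y → x ∈ p
x∈p-y⇒x∈p {p = p} {y = y} = p─q⊆p p ⁅ y ⁆

p⊆r∧x∈r⇒p∪⁅x⁆⊆r : ∀ {n} {p r : Subset n} {x} → p ⊆ r → x ∈ r → p ∪ ⁅ x ⁆ ⊆ r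
p⊆r∧x∈r⇒p∪⁅x⁆⊆r {p = p} {x = x} p⊆r x∈r y∈ with x∈p∪q⁻ p ⁅ x ⁆ y∈
... | inj₁ y∈p = p⊆r y∈p
... | inj₂ y∈⁅x⁆ rewrite x∈⁅y⁆⇒x≡y x y∈⁅x⁆ = x∈r

p⊆q∪⁅x⁆⇒p-x⊆q : ∀ {n} {p q : Subset n} {x} → p ⊆ q ∪ ⁅ x ⁆ → p - x ⊆ q
p⊆q∪⁅x⁆⇒p-x⊆q {q = q} {x} p⊆q+x y∈p-x with x∈p∪q⁻ q ⁅ x ⁆ (p⊆q+x (x∈p-y⇒x∈p y∈p-x))
... | inj₁ y∈q = y∈q
... | inj₂ y∈⁅x⁆ = contradiction (x∈⁅y⁆⇒x≡y x y∈⁅x⁆) (x∈p-y⇒x≢y y∈p-x)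

x∉p∧p⊆q∪⁅x⁆⇒p⊆q : ∀ {n} {p q : Subset n} {x} → x ∉ p → p ⊆ q ∪ ⁅ x ⁆ → p ⊆ q
x∉p∧p⊆q∪⁅x⁆⇒p⊆q {q = q} {x} x∉p p⊆q+x {y} y∈p with x∈p∪q⁻ q ⁅ x ⁆ (p⊆q+x y∈p)
... | inj₁ y∈q = y∈q
... | inj₂ y∈⁅x⁆ = contradiction (subst (_∈ _) (x∈⁅y⁆⇒x≡y x y∈⁅x⁆) y∈p) x∉p

p-x∪⁅x⁆≡p : ∀ {n} {p : Subset n} {x} → x ∈ p → (p - x) ∪ ⁅ x ⁆ ≡ p
p-x∪⁅x⁆≡p {p = p} {x} x∈p = ⊆-antisym (p⊆r∧x∈r⇒p∪⁅x⁆⊆r x∈p-y⇒x∈p x∈p) p⊆p-x∪⁅x⁆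
  where
  p⊆p-x∪⁅x⁆ : p ⊆ (p - x) ∪ ⁅ x ⁆
  p⊆p-x∪⁅x⁆ {y} y∈p with y ≟ᶠ x
  ... | yes refl = x∈p∪q⁺ (inj₂ (x∈⁅x⁆ y))
  ... | no y≢x = x∈p∪q⁺ (inj₁ (x∈p∧x≢y⇒x∈p-y y∈p y≢x))

∣p∣≡1+∣p-x∣ : ∀ {n} {p : Subset n} {x} → x ∈ p → ∣ p ∣ ≡ suc ∣ p - x ∣
∣p∣≡1+∣p-x∣ {p = p} {x} x∈p = begin
  ∣ p ∣               ≡⟨ cong ∣_∣ (p-x∪⁅x⁆≡p x∈p) ⟨
  ∣ (p - x) ∪ ⁅ x ⁆ ∣ ≡⟨ ∣p∪⁅x⁆∣≡1+∣p∣ (x∉p-x p x) ⟩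
  suc ∣ p - x ∣       ∎
  where open ≡-Reasoning

p⊈q⇒∃∈p∉q : ∀ {n} {p q : Subset n} → ¬ p ⊆ q → ∃ λ x → x ∈ p × x ∉ q
p⊈q⇒∃∈p∉q {n} {p} {q} p⊈q
  with ¬∀⟶∃¬ n (λ x → x ∈ p → x ∈ q) (λ x → (x ∈? p) →-dec (x ∈? q)) (λ p⊆q → p⊈q (p⊆q _))
... | x , x∈p⇏x∈q =
  x , decidable-stable (x ∈? p) (λ x∉p → x∈p⇏x∈q (⊥-elim ∘ x∉p)) , x∈p⇏x∈q ∘ λ x∈q _ → x∈q

p⊆q∧q⊈p⇒∣p∣<∣q∣ : ∀ {n} {p q : Subset n} → p ⊆ q → ¬ q ⊆ p → ∣ p ∣ < ∣ q ∣
p⊆q∧q⊈p⇒∣p∣<∣q∣ p⊆q q⊈p = p⊂q⇒∣p∣<∣q∣ (p⊆q , p⊈q⇒∃∈p∉q q⊈p)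

p⊆q∧∣q∣≤∣p∣⇒p≡q : ∀ {n} {p q : Subset n} → p ⊆ q → ∣ q ∣ ≤ ∣ p ∣ → p ≡ q
p⊆q∧∣q∣≤∣p∣⇒p≡q {p = p} {q} p⊆q ∣q∣≤∣p∣ with q ⊆? p
... | yes q⊆p = ⊆-antisym p⊆q q⊆p
... | no q⊈p = contradiction ∣q∣≤∣p∣ (<⇒≱ (p⊆q∧q⊈p⇒∣p∣<∣q∣ p⊆q q⊈p))

∣p∣≡0⇒p≡⊥ : ∀ {n} {p : Subset n} → ∣ p ∣ ≡ 0 → p ≡ ⊥
∣p∣≡0⇒p≡⊥ {p = []} _ = refl
∣p∣≡0⇒p≡⊥ {p = false ∷ p} ∣p∣≡0 = cong (outside ∷_) (∣p∣≡0⇒p≡⊥ ∣p∣≡0)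

∣p∣≡1⇒p≡⁅x⁆ : ∀ {n} {p : Subset n} → ∣ p ∣ ≡ 1 → ∃ λ x → p ≡ ⁅ x ⁆
∣p∣≡1⇒p≡⁅x⁆ {p = true ∷ p} ∣p∣≡1 = zero , cong (inside ∷_) (∣p∣≡0⇒p≡⊥ (suc-injective ∣p∣≡1))
∣p∣≡1⇒p≡⁅x⁆ {p = false ∷ p} ∣p∣≡1 =
  let x , p≡⁅x⁆ = ∣p∣≡1⇒p≡⁅x⁆ ∣p∣≡1 in suc x , cong (outside ∷_) p≡⁅x⁆

⊆-of-size : ∀ {n} k (p : Subset n) → k ≤ ∣ p ∣ → ∃ λ q → q ⊆ p × ∣ q ∣ ≡ k
⊆-of-size {n} zero p _ = ⊥ , ⊥⊆ , ∣⊥∣≡0 n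
⊆-of-size (suc k) (false ∷ p) k<∣p∣ =
  let q , q⊆p , ∣q∣≡k = ⊆-of-size (suc k) p k<∣p∣ in outside ∷ q , out⊆ q⊆p , ∣q∣≡k
⊆-of-size (suc k) (true ∷ p) k<∣p∣ =
  let q , q⊆p , ∣q∣≡k = ⊆-of-size k p (s≤s⁻¹ k<∣p∣) in inside ∷ q , in⊆in q⊆p , cong suc ∣q∣≡k

injective⇒∣p∣≤∣q∣ : ∀ {m n} {p : Subset m} {q : Subset n} (f : Fin m → Fin n) →
  Injective _≡_ _≡_ f → (∀ {x} → x ∈ p → f x ∈ q) → ∣ p ∣ ≤ ∣ q ∣
injective⇒∣p∣≤∣q∣ {p = []} f _ _ = z≤n
injective⇒∣p∣≤∣q∣ {p = false ∷ p} f f-inj f[p]⊆q =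
  injective⇒∣p∣≤∣q∣ (f ∘ suc) (fsuc-injective ∘ f-inj) (f[p]⊆q ∘ there)
injective⇒∣p∣≤∣q∣ {p = true ∷ p} {q} f f-inj f[p]⊆q = begin
  suc ∣ p ∣          ≤⟨ s≤s (injective⇒∣p∣≤∣q∣ (f ∘ suc) (fsuc-injective ∘ f-inj) f[p]⊆q-f0) ⟩
  suc ∣ q - f zero ∣ ≡⟨ ∣p∣≡1+∣p-x∣ (f[p]⊆q here) ⟨
  ∣ q ∣              ∎
  where
  open ≤-Reasoning
  f[p]⊆q-f0 : ∀ {x} → x ∈ p → f (suc x) ∈ q - f zero
  f[p]⊆q-f0 x∈p = x∈p∧x≢y⇒x∈p-y (f[p]⊆q (there x∈p)) (fzero≢fsuc ∘ sym ∘ f-inj)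

injective? : ∀ {k m} (f : Fin k → Fin m) → Dec (Injective _≡_ _≡_ f)
injective? f = map′ (λ inj {i} {j} → inj i j) (λ inj i j → inj)
  (all? λ i → all? λ j → (f i ≟ᶠ f j) →-dec (i ≟ᶠ j))

preimage : ∀ {m n} → (Fin m → Fin n) → Subset n → Subset m
preimage f p = tabulate (lookup p ∘ f)

∈-preimage⁺ : ∀ {m n} {f : Fin m → Fin n} {p x} → f x ∈ p → x ∈ preimage f p
∈-preimage⁺ {f = f} {p} {x} fx∈p =
  lookup⇒[]= x (preimage f p) (trans (lookup∘tabulate (lookup p ∘ f) x) ([]=⇒lookup fx∈p))

∈-preimage⁻ : ∀ {m n} {f : Fin m → Fin n} {p x} → x ∈ preimage f p → f x ∈ p
∈-preimage⁻ {f = f} {p} {x} x∈ =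
  lookup⇒[]= (f x) p (trans (sym (lookup∘tabulate (lookup p ∘ f) x)) ([]=⇒lookup x∈))

∣p∣≡∣p↑ˡ∣+∣p↑ʳ∣ : ∀ a {b} (p : Subset (a + b)) →
  ∣ p ∣ ≡ ∣ preimage (_↑ˡ b) p ∣ + ∣ preimage (a ↑ʳ_) p ∣
∣p∣≡∣p↑ˡ∣+∣p↑ʳ∣ zero p = cong ∣_∣ (sym (tabulate∘lookup p))
∣p∣≡∣p↑ˡ∣+∣p↑ʳ∣ (suc a) (true ∷ p) = cong suc (∣p∣≡∣p↑ˡ∣+∣p↑ʳ∣ a p)
∣p∣≡∣p↑ˡ∣+∣p↑ʳ∣ (suc a) (false ∷ p) = ∣p∣≡∣p↑ˡ∣+∣p↑ʳ∣ a p

∉⇒lookup≡false : ∀ {n} {p : Subset n} {x} → x ∉ p → lookup p x ≡ false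
∉⇒lookup≡false {p = p} {x} x∉p with lookup p x in lookup≡
... | true = contradiction (lookup⇒[]= x p lookup≡) x∉p
... | false = refl

-- Flats

RaisesRank : ∀ {m} → (Subset m → Set) → Subset m → Fin m → Set
RaisesRank {m} Indep F e =
  Σ (Subset m) λ I → I ⊆ (F ∪ ⁅ e ⁆) × Indep I ×
    ((J : Subset m) → J ⊆ F → Indep J → ∣ J ∣ < ∣ I ∣)

independent-extension-raises-rank : ∀ {m} {Indep : Subset m → Set} {F e} →
  e ∉ F → Indep (F ∪ ⁅ e ⁆) → RaisesRank Indep F e
independent-extension-raises-rank {F = F} {e} e∉F indep =
  F ∪ ⁅ e ⁆ , id , indep , λ J J⊆F _ → begin-strict
    ∣ J ∣             ≤⟨ p⊆q⇒∣p∣≤∣q∣ J⊆F ⟩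
    ∣ F ∣             <⟨ n<1+n ∣ F ∣ ⟩
    suc ∣ F ∣         ≡⟨ ∣p∪⁅x⁆∣≡1+∣p∣ e∉F ⟨
    ∣ F ∪ ⁅ e ⁆ ∣     ∎
  where open ≤-Reasoning

⊤-flat : ∀ {m} (Indep : Subset m → Set) → IsFlat Indep ⊤
⊤-flat _ e e∉⊤ = contradiction ∈⊤ e∉⊤

module UniformMatroid {m} (Indep : Subset m → Set) (r : ℕ)
  (indep⇒∣∣≤r : ∀ {X} → Indep X → ∣ X ∣ ≤ r) (∣∣≤r⇒indep : ∀ {X} → ∣ X ∣ ≤ r → Indep X) where

  small⇒flat : ∀ {F} → ∣ F ∣ < r → IsFlat Indep F
  small⇒flat {F} ∣F∣<r e e∉F = independent-extension-raises-rank e∉F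
    (∣∣≤r⇒indep (≤-trans (≤-reflexive (∣p∪⁅x⁆∣≡1+∣p∣ e∉F)) ∣F∣<r))

  flat⇒small-or-⊤ : ∀ {F} → IsFlat Indep F → ∣ F ∣ < r ⊎ F ≡ ⊤
  flat⇒small-or-⊤ {F} F-flat with ⊤ ⊆? F
  ... | yes ⊤⊆F = inj₂ (⊆-antisym ⊆⊤ ⊤⊆F)
  ... | no ⊤⊈F = inj₁ (≰⇒> r≰∣F∣)
    where
    r≰∣F∣ : ¬ r ≤ ∣ F ∣
    r≰∣F∣ r≤∣F∣ =
      let e , _ , e∉F = p⊈q⇒∃∈p∉q ⊤⊈F
          I , _ , indep-I , I-beats = F-flat e e∉F
          J , J⊆F , ∣J∣≡r = ⊆-of-size r F r≤∣F∣
          r<∣I∣ = subst (_< ∣ I ∣) ∣J∣≡r (I-beats J J⊆F (∣∣≤r⇒indep (≤-reflexive ∣J∣≡r)))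
      in <⇒≱ r<∣I∣ (indep⇒∣∣≤r indep-I)

-- The cyclic successor

toℕ-next : ∀ {k} (i : Fin (suc k)) →
  (toℕ i ≡ k × next i ≡ zero) ⊎ (toℕ i < k × toℕ (next i) ≡ suc (toℕ i))
toℕ-next {k} i with k ≟ toℕ i
... | yes k≡i = inj₁ (sym k≡i , refl)
... | no k≢i = inj₂ (≤∧≢⇒< (s≤s⁻¹ (toℕ<n i)) (k≢i ∘ sym) , cong suc (toℕ-lower₁ i k≢i))

next-fromℕ : ∀ k → next (fromℕ k) ≡ zero
next-fromℕ k with toℕ-next (fromℕ k)
... | inj₁ (_ , next≡0) = next≡0
... | inj₂ (k<k , _) = contradiction (subst (_< k) (toℕ-fromℕ k) k<k) (n≮n k)

toℕ-next-< : ∀ {k} {i : Fin (suc k)} → toℕ i < k → toℕ (next i) ≡ suc (toℕ i)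
toℕ-next-< {i = i} i<k with toℕ-next i
... | inj₁ (i≡k , _) = contradiction (subst (_< _) i≡k i<k) (n≮n _)
... | inj₂ (_ , toℕ-next≡) = toℕ-next≡

next-injective : ∀ {k} → Injective _≡_ _≡_ (next {suc k})
next-injective {k} {i} {j} next-i≡next-j with toℕ-next i | toℕ-next j
... | inj₁ (i≡k , _) | inj₁ (j≡k , _) = toℕ-injective (trans i≡k (sym j≡k))
... | inj₂ (_ , i′) | inj₂ (_ , j′) =
  toℕ-injective (suc-injective (trans (sym i′) (trans (cong toℕ next-i≡next-j) j′)))
... | inj₁ (_ , i′) | inj₂ (_ , j′) = contradiction (trans (cong toℕ (trans (sym i′) next-i≡next-j)) j′) (λ ())
... | inj₂ (_ , i′) | inj₁ (_ , j′) = contradiction (trans (cong toℕ (trans (sym j′) (sym next-i≡next-j))) i′) (λ ())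

next-surjective : ∀ {k} (i : Fin (suc k)) → ∃ λ j → next j ≡ i
next-surjective {k} zero = fromℕ k , next-fromℕ k
next-surjective {suc k} (suc i) = inject₁ i , toℕ-injective (begin
  toℕ (next (inject₁ i)) ≡⟨ toℕ-next-< (subst (_< suc k) (sym (toℕ-inject₁ i)) (toℕ<n i)) ⟩
  suc (toℕ (inject₁ i))  ≡⟨ cong suc (toℕ-inject₁ i) ⟩
  suc (toℕ i)            ∎)
  where open ≡-Reasoning

next^ : ∀ {n} → ℕ → Fin n → Fin n
next^ zero i = i
next^ (suc t) i = next (next^ t i)

next^-injective : ∀ {k} t → Injective _≡_ _≡_ (next^ {suc k} t)
next^-injective zero eq = eq
next^-injective (suc t) eq = next^-injective t (next-injective eq)

next^-next : ∀ {k} t (i : Fin (suc k)) → next^ t (next i) ≡ next (next^ t i)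
next^-next zero i = refl
next^-next (suc t) i = cong next (next^-next t i)

next^-+ : ∀ {k} s t (i : Fin (suc k)) → next^ (s + t) i ≡ next^ s (next^ t i)
next^-+ zero t i = refl
next^-+ (suc s) t i = cong next (next^-+ s t i)

toℕ-next^ : ∀ {k} t (i : Fin (suc k)) → toℕ i + t ≤ k → toℕ (next^ t i) ≡ toℕ i + t
toℕ-next^ zero i _ = sym (+-identityʳ (toℕ i))
toℕ-next^ {k} (suc t) i i+1+t≤k = begin
  toℕ (next (next^ t i)) ≡⟨ toℕ-next-< (subst (_< k) (sym IH) (subst (_≤ k) (+-suc (toℕ i) t) i+1+t≤k)) ⟩
  suc (toℕ (next^ t i))  ≡⟨ cong suc IH ⟩
  suc (toℕ i + t)        ≡⟨ +-suc (toℕ i) t ⟨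
  toℕ i + suc t          ∎
  where
  open ≡-Reasoning
  IH : toℕ (next^ t i) ≡ toℕ i + t
  IH = toℕ-next^ t i (≤-trans (+-monoʳ-≤ (toℕ i) (n≤1+n t)) i+1+t≤k)

next^-reaches : ∀ {k} (i j : Fin (suc k)) → ∃ λ t → next^ t i ≡ j
next^-reaches {k} i j = toℕ j + suc (k ∸ toℕ i) , (begin
  next^ (toℕ j + suc (k ∸ toℕ i)) i          ≡⟨ next^-+ (toℕ j) (suc (k ∸ toℕ i)) i ⟩
  next^ (toℕ j) (next (next^ (k ∸ toℕ i) i)) ≡⟨ cong (next^ (toℕ j) ∘ next) i↝last ⟩
  next^ (toℕ j) (next (fromℕ k))             ≡⟨ cong (next^ (toℕ j)) (next-fromℕ k) ⟩
  next^ (toℕ j) zero                         ≡⟨ toℕ-injective (toℕ-next^ (toℕ j) zero (s≤s⁻¹ (toℕ<n j))) ⟩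
  j                                          ∎)
  where
  open ≡-Reasoning
  i+[k∸i]≡k : toℕ i + (k ∸ toℕ i) ≡ k
  i+[k∸i]≡k = m+[n∸m]≡n (s≤s⁻¹ (toℕ<n i))
  i↝last : next^ (k ∸ toℕ i) i ≡ fromℕ k
  i↝last = toℕ-injective (trans (toℕ-next^ (k ∸ toℕ i) i (≤-reflexive i+[k∸i]≡k))
                                (trans i+[k∸i]≡k (sym (toℕ-fromℕ k))))

prev^ : ∀ {k} → ℕ → Fin (suc k) → Fin (suc k)
prev^ zero i = i
prev^ (suc t) i = prev^ t (proj₁ (next-surjective i))

next^∘prev^ : ∀ {k} t (i : Fin (suc k)) → next^ t (prev^ t i) ≡ i
next^∘prev^ zero i = refl
next^∘prev^ (suc t) i = trans (cong next (next^∘prev^ t _)) (proj₂ (next-surjective i))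

≢fromℕ⇒toℕ< : ∀ {m} {i : Fin (suc m)} → i ≢ fromℕ m → toℕ i < m
≢fromℕ⇒toℕ< {m} {i} i≢last =
  ≤∧≢⇒< (s≤s⁻¹ (toℕ<n i)) λ i≡m → i≢last (toℕ-injective (trans i≡m (sym (toℕ-fromℕ m))))

pos : ∀ {m} → ℕ → Fin (suc m)
pos {m} t = t mod suc m

toℕ-pos : ∀ {m t} → t ≤ m → toℕ (pos {m} t) ≡ t
toℕ-pos {m} {t} t≤m = trans (toℕ-fromℕ< (m%n<n t (suc m))) (m<n⇒m%n≡m (s≤s t≤m))

next-pos : ∀ {m t} → t < m → next (pos {m} t) ≡ pos (suc t)
next-pos {m} {t} t<m = toℕ-injective (begin
  toℕ (next (pos t)) ≡⟨ toℕ-next-< (subst (_< m) (sym (toℕ-pos (<⇒≤ t<m))) t<m) ⟩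
  suc (toℕ (pos t))  ≡⟨ cong suc (toℕ-pos (<⇒≤ t<m)) ⟩
  suc t              ≡⟨ toℕ-pos t<m ⟨
  toℕ (pos (suc t))  ∎)
  where open ≡-Reasoning

-- Cycles and forests

Joins-sym : ∀ G {e u w} → Joins G e u w → Joins G e w u
Joins-sym _ (inj₁ ends≡uw) = inj₂ ends≡uw
Joins-sym _ (inj₂ ends≡wu) = inj₁ ends≡wu

loopless : ∀ G → (∀ e → proj₁ (ends G e) ≢ proj₂ (ends G e)) → ∀ {e u} → ¬ Joins G e u u
loopless G distinct-ends {e} (inj₁ ends≡uu) = distinct-ends e (trans (cong proj₁ ends≡uu) (sym (cong proj₂ ends≡uu)))
loopless G distinct-ends {e} (inj₂ ends≡uu) = distinct-ends e (trans (cong proj₁ ends≡uu) (sym (cong proj₂ ends≡uu)))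

Joins-same-ends : ∀ G {e e′ u w} → Joins G e u w → Joins G e′ u w →
  ends G e ≡ ends G e′ ⊎ ends G e ≡ swap (ends G e′)
Joins-same-ends G (inj₁ e≡uw) (inj₁ e′≡uw) = inj₁ (trans e≡uw (sym e′≡uw))
Joins-same-ends G (inj₂ e≡wu) (inj₂ e′≡wu) = inj₁ (trans e≡wu (sym e′≡wu))
Joins-same-ends G (inj₁ e≡uw) (inj₂ e′≡wu) = inj₂ (trans e≡uw (sym (cong swap e′≡wu)))
Joins-same-ends G (inj₂ e≡wu) (inj₁ e′≡uw) = inj₂ (trans e≡wu (sym (cong swap e′≡uw)))

forest-antitone : ∀ G {X Y} → X ⊆ Y → Forest G Y → Forest G X
forest-antitone G X⊆Y Y-forest c = Y-forest record
  { len = len ; verts = verts ; edges = edges ; vinj = vinj ; einj = einj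
  ; inX = X⊆Y ∘ inX ; joins = joins }
  where open Cycle c

cycle-length<∣X∣ : ∀ {G X} (c : Cycle G X) → Cycle.len c < ∣ X ∣
cycle-length<∣X∣ {X = X} c = begin-strict
  len                  <⟨ n<1+n len ⟩
  suc len              ≡⟨ ∣⊤∣≡n (suc len) ⟨
  ∣ ⊤ {suc len} ∣      ≤⟨ injective⇒∣p∣≤∣q∣ {p = ⊤} edges einj (λ {i} _ → inX i) ⟩
  ∣ X ∣                ∎
  where
  open Cycle c
  open ≤-Reasoning

forest-if-∣X∣≤2 : ∀ G {X} → ∣ X ∣ ≤ 2 →
  (∀ {e u} → e ∈ X → ¬ Joins G e u u) →
  (∀ {e e′ u w} → e ∈ X → e′ ∈ X → Joins G e u w → Joins G e′ u w → e ≡ e′) →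
  Forest G X
forest-if-∣X∣≤2 G ∣X∣≤2 no-loop simple c@record { len = zero } = no-loop (inX zero) (joins zero)
  where open Cycle c
forest-if-∣X∣≤2 G ∣X∣≤2 no-loop simple c@record { len = suc zero } =
  fzero≢fsuc (einj (simple (inX zero) (inX (suc zero)) (joins zero) (Joins-sym G (joins (suc zero)))))
  where open Cycle c
forest-if-∣X∣≤2 G ∣X∣≤2 no-loop simple c@record { len = suc (suc _) } =
  3+k≰2 (≤-trans (cycle-length<∣X∣ c) ∣X∣≤2)
  where
  3+k≰2 : ∀ {k} → ¬ 3 + k ≤ 2
  3+k≰2 (s≤s (s≤s ()))

record Embedding (G H : Graph) : Set where
  field
    vmap : Fin (nV G) → Fin (nV H)
    emap : Fin (nE G) → Fin (nE H)
    vmap-injective : Injective _≡_ _≡_ vmap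
    emap-injective : Injective _≡_ _≡_ emap
    preserves-Joins : ∀ {e u w} → Joins G e u w → Joins H (emap e) (vmap u) (vmap w)

forest-pullback : ∀ {G H X Y} (φ : Embedding G H) → (∀ {e} → e ∈ X → Embedding.emap φ e ∈ Y) →
  Forest H Y → Forest G X
forest-pullback φ φ[X]⊆Y Y-forest c = Y-forest record
  { len = len ; verts = vmap ∘ verts ; edges = emap ∘ edges
  ; vinj = vinj ∘ vmap-injective ; einj = einj ∘ emap-injective
  ; inX = φ[X]⊆Y ∘ inX ; joins = preserves-Joins ∘ joins }
  where
  open Cycle c
  open Embedding φ

argmin : ∀ {k} (f : Fin (suc k) → ℕ) → ∃ λ i → ∀ j → f i ≤ f j
argmin {zero} f = zero , λ { zero → ≤-refl }
argmin {suc k} f with argmin (f ∘ suc)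
... | i , f[1+i]-min with f zero ≤? f (suc i)
...   | yes f0≤ = zero , λ { zero → ≤-refl ; (suc j) → ≤-trans f0≤ (f[1+i]-min j) }
...   | no f0≰ = suc i , λ { zero → <⇒≤ (≰⇒> f0≰) ; (suc j) → f[1+i]-min j }

-- At a vertex of minimal potential on a cycle both cycle edges ascend, so they coincide.
forest-from-potential : ∀ G {X} (h : Fin (nV G) → ℕ) (up : Fin (nV G) → Fin (nE G)) →
  (∀ {e u w} → e ∈ X → Joins G e u w → h u ≢ h w) →
  (∀ {e u w} → e ∈ X → Joins G e u w → h u < h w → e ≡ up u) →
  Forest G X
forest-from-potential G {X} h up separates ascent-is-up c =
  separates (inX i) (subst (Joins G (edges i) (verts i) ∘ verts) next-i≡i (joins i)) refl
  where
  open Cycle c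
  i : Fin (suc len)
  i = proj₁ (argmin (h ∘ verts))
  i-min : ∀ k → h (verts i) ≤ h (verts k)
  i-min = proj₂ (argmin (h ∘ verts))
  j : Fin (suc len)
  j = proj₁ (next-surjective i)
  next-j≡i : next j ≡ i
  next-j≡i = proj₂ (next-surjective i)
  ascends : ∀ {e w} → e ∈ X → Joins G e (verts i) (verts w) → h (verts i) < h (verts w)
  ascends e∈X joins-e = ≤∧≢⇒< (i-min _) (separates e∈X joins-e)
  joins-j : Joins G (edges j) (verts i) (verts j)
  joins-j = Joins-sym G (subst (Joins G (edges j) (verts j) ∘ verts) next-j≡i (joins j))
  i≡j : i ≡ j
  i≡j = einj (trans (ascent-is-up (inX i) (joins i) (ascends (inX i) (joins i)))
                    (sym (ascent-is-up (inX j) joins-j (ascends (inX j) joins-j))))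
  next-i≡i : next i ≡ i
  next-i≡i = trans (cong next i≡j) next-j≡i

-- The matroids W¹ and W²

W¹-independent : ∀ X → W¹Indep X
W¹-independent X = forest-if-∣X∣≤2 G₁ (≤-trans (∣p∣≤n X) (s≤s z≤n)) (λ {e} _ → loopless G₁ (λ _ ()) {e})
  λ { {zero} {zero} _ _ _ _ → refl }

module W¹ = UniformMatroid W¹Indep 1 (λ {X} _ → ∣p∣≤n X) (λ {X} _ → W¹-independent X)

W¹-flats : DisjointUnionOfFlats W¹Indep L₁-W¹ L₂-W¹
W¹-flats = (λ F F-flat → [ inj₁ ∘ ∣p∣≡0⇒p≡⊥ ∘ n<1⇒n≡0 , inj₂ ]′ (W¹.flat⇒small-or-⊤ F-flat))
         , (λ { F (inj₁ refl) → W¹.small⇒flat (s≤s z≤n) ; F (inj₂ refl) → ⊤-flat W¹Indep })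
         , λ { F (refl , ()) }

H₂-loopless : ∀ {e u} → ¬ Joins H₂ e u u
H₂-loopless {e} = loopless H₂ (λ { zero () ; (suc zero) () ; (suc (suc zero)) () ; (suc (suc (suc zero))) () }) {e}

H₂-parallel-pairs : ∀ e e′ → endsH e ≡ endsH e′ ⊎ endsH e ≡ swap (endsH e′) →
  e ≡ e′ ⊎ (e ≡ e₁ × e′ ≡ e₂) ⊎ (e ≡ e₂ × e′ ≡ e₁)
H₂-parallel-pairs = from-yes (all? λ e → all? λ e′ →
  (endsH e ≟ᵉ endsH e′ ⊎-dec endsH e ≟ᵉ swap (endsH e′)) →-dec
  (e ≟ᶠ e′ ⊎-dec (e ≟ᶠ e₁ ×-dec e′ ≟ᶠ e₂) ⊎-dec (e ≟ᶠ e₂ ×-dec e′ ≟ᶠ e₁)))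
  where
  _≟ᵉ_ : DecidableEquality (Fin 3 × Fin 3)
  _≟ᵉ_ = ≡-dec _≟ᶠ_ _≟ᶠ_

H₂-parallel : ∀ {e e′ u w} → Joins H₂ e u w → Joins H₂ e′ u w →
  e ≡ e′ ⊎ (e ≡ e₁ × e′ ≡ e₂) ⊎ (e ≡ e₂ × e′ ≡ e₁)
H₂-parallel {e} {e′} joins joins′ = H₂-parallel-pairs e e′ (Joins-same-ends H₂ joins joins′)

H₂-simple : ∀ {X} → ¬ (e₁ ∈ X × e₂ ∈ X) →
  ∀ {e e′ u w} → e ∈ X → e′ ∈ X → Joins H₂ e u w → Joins H₂ e′ u w → e ≡ e′
H₂-simple not-both e∈X e′∈X joins joins′ with H₂-parallel joins joins′
... | inj₁ e≡e′ = e≡e′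
... | inj₂ (inj₁ (refl , refl)) = contradiction (e∈X , e′∈X) not-both
... | inj₂ (inj₂ (refl , refl)) = contradiction (e′∈X , e∈X) not-both

W²-independent : ∀ {X} → ∣ X ∣ ≤ 2 → W²Indep X
W²-independent {X} ∣X∣≤2 with e₁ ∈? X ×-dec e₂ ∈? X
... | yes (e₁∈X , e₂∈X) = inj₂ (sym (p⊆q∧∣q∣≤∣p∣⇒p≡q (p⊆r∧x∈r⇒p∪⁅x⁆⊆r ⁅e₁⁆⊆X e₂∈X) ∣X∣≤2))
  where
  ⁅e₁⁆⊆X : ⁅ e₁ ⁆ ⊆ X
  ⁅e₁⁆⊆X x∈⁅e₁⁆ rewrite x∈⁅y⁆⇒x≡y e₁ x∈⁅e₁⁆ = e₁∈X
... | no not-both = inj₁ (forest-if-∣X∣≤2 H₂ ∣X∣≤2 (λ _ → H₂-loopless) (H₂-simple not-both))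

parallel-cycle : ∀ {X} → e₁ ∈ X → e₂ ∈ X → Cycle H₂ X
parallel-cycle e₁∈X e₂∈X = record
  { len = 1 ; verts = verts ; edges = edges
  ; vinj = from-yes (injective? verts) ; einj = from-yes (injective? edges)
  ; inX = λ { zero → e₁∈X ; (suc zero) → e₂∈X }
  ; joins = λ { zero → inj₁ refl ; (suc zero) → inj₂ refl } }
  where
  verts : Fin 2 → Fin 3
  verts zero = suc zero
  verts (suc zero) = suc (suc zero)
  edges : Fin 2 → Fin 4
  edges zero = e₁
  edges (suc zero) = e₂

triangle-edges : Fin 4 → Fin 3 → Fin 4
triangle-edges e zero = e₀₁
triangle-edges e (suc zero) = e
triangle-edges e (suc (suc zero)) = e₀₂

triangle : ∀ {X} e → Injective _≡_ _≡_ (triangle-edges e) → endsH e ≡ (suc zero , suc (suc zero)) →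
  e₀₁ ∈ X → e ∈ X → e₀₂ ∈ X → Cycle H₂ X
triangle e einj ends-e e₀₁∈X e∈X e₀₂∈X = record
  { len = 2 ; verts = id ; edges = triangle-edges e ; vinj = id ; einj = einj
  ; inX = λ { zero → e₀₁∈X ; (suc zero) → e∈X ; (suc (suc zero)) → e₀₂∈X }
  ; joins = λ { zero → inj₁ refl ; (suc zero) → inj₁ ends-e ; (suc (suc zero)) → inj₂ refl } }

H₂-dense-cycle : ∀ X → 2 < ∣ X ∣ → Cycle H₂ X
H₂-dense-cycle (_ ∷ _ ∷ true ∷ true ∷ []) _ = parallel-cycle (there (there here)) (there (there (there here)))
H₂-dense-cycle (true ∷ true ∷ true ∷ false ∷ []) _ =
  triangle e₁ (from-yes (injective? (triangle-edges e₁))) refl here (there (there here)) (there here)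
H₂-dense-cycle (true ∷ true ∷ false ∷ true ∷ []) _ =
  triangle e₂ (from-yes (injective? (triangle-edges e₂))) refl here (there (there (there here))) (there here)
H₂-dense-cycle (true ∷ true ∷ false ∷ false ∷ []) (s≤s (s≤s ()))
H₂-dense-cycle (true ∷ false ∷ true ∷ false ∷ []) (s≤s (s≤s ()))
H₂-dense-cycle (true ∷ false ∷ false ∷ true ∷ []) (s≤s (s≤s ()))
H₂-dense-cycle (true ∷ false ∷ false ∷ false ∷ []) (s≤s ())
H₂-dense-cycle (false ∷ true ∷ true ∷ false ∷ []) (s≤s (s≤s ()))
H₂-dense-cycle (false ∷ true ∷ false ∷ true ∷ []) (s≤s (s≤s ()))
H₂-dense-cycle (false ∷ true ∷ false ∷ false ∷ []) (s≤s ())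
H₂-dense-cycle (false ∷ false ∷ true ∷ false ∷ []) (s≤s ())
H₂-dense-cycle (false ∷ false ∷ false ∷ true ∷ []) (s≤s ())
H₂-dense-cycle (false ∷ false ∷ false ∷ false ∷ []) ()

W²-rank : ∀ {X} → W²Indep X → ∣ X ∣ ≤ 2
W²-rank (inj₂ refl) = ≤-refl
W²-rank {X} (inj₁ X-forest) with ∣ X ∣ ≤? 2
... | yes ∣X∣≤2 = ∣X∣≤2
... | no ∣X∣≰2 = contradiction (H₂-dense-cycle X (≰⇒> ∣X∣≰2)) X-forest

module W² = UniformMatroid W²Indep 2 W²-rank W²-independent

small-or-⊤⇒L-W² : ∀ {F} → ∣ F ∣ < 2 ⊎ F ≡ ⊤ → L₁-W² F ⊎ L₂-W² F
small-or-⊤⇒L-W² (inj₂ refl) = inj₂ (inj₂ (inj₂ (inj₂ refl)))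
small-or-⊤⇒L-W² {F} (inj₁ ∣F∣<2) with m≤n⇒m<n∨m≡n (s≤s⁻¹ ∣F∣<2)
... | inj₁ ∣F∣<1 = inj₂ (inj₁ (∣p∣≡0⇒p≡⊥ (n<1⇒n≡0 ∣F∣<1)))
... | inj₂ ∣F∣≡1 with ∣p∣≡1⇒p≡⁅x⁆ {p = F} ∣F∣≡1
...   | zero , refl = inj₂ (inj₂ (inj₁ refl))
...   | suc zero , refl = inj₂ (inj₂ (inj₂ (inj₁ refl)))
...   | suc (suc zero) , refl = inj₁ (inj₁ refl)
...   | suc (suc (suc zero)) , refl = inj₁ (inj₂ refl)

L-W²⇒flat : ∀ {F} → L₁-W² F ⊎ L₂-W² F → IsFlat W²Indep F
L-W²⇒flat (inj₂ (inj₂ (inj₂ (inj₂ refl)))) = ⊤-flat W²Indep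
L-W²⇒flat (inj₂ (inj₁ refl)) = W².small⇒flat (s≤s z≤n)
L-W²⇒flat (inj₂ (inj₂ (inj₁ refl))) = W².small⇒flat ≤-refl
L-W²⇒flat (inj₂ (inj₂ (inj₂ (inj₁ refl)))) = W².small⇒flat ≤-refl
L-W²⇒flat (inj₁ (inj₁ refl)) = W².small⇒flat ≤-refl
L-W²⇒flat (inj₁ (inj₂ refl)) = W².small⇒flat ≤-refl

L₁-W²∩L₂-W²≡∅ : ∀ F → ¬ (L₁-W² F × L₂-W² F)
L₁-W²∩L₂-W²≡∅ F (inj₁ refl , inj₁ ())
L₁-W²∩L₂-W²≡∅ F (inj₁ refl , inj₂ (inj₁ ()))
L₁-W²∩L₂-W²≡∅ F (inj₁ refl , inj₂ (inj₂ (inj₁ ())))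
L₁-W²∩L₂-W²≡∅ F (inj₁ refl , inj₂ (inj₂ (inj₂ ())))
L₁-W²∩L₂-W²≡∅ F (inj₂ refl , inj₁ ())
L₁-W²∩L₂-W²≡∅ F (inj₂ refl , inj₂ (inj₁ ()))
L₁-W²∩L₂-W²≡∅ F (inj₂ refl , inj₂ (inj₂ (inj₁ ())))
L₁-W²∩L₂-W²≡∅ F (inj₂ refl , inj₂ (inj₂ (inj₂ ())))

W²-flats : DisjointUnionOfFlats W²Indep L₁-W² L₂-W²
W²-flats = (λ F → small-or-⊤⇒L-W² ∘ W².flat⇒small-or-⊤) , (λ F → L-W²⇒flat) , L₁-W²∩L₂-W²≡∅

-- The wheel

rim spoke : ∀ {n} → Fin n → Fin (n + n)
rim {n} i = i ↑ˡ n
spoke {n} i = n ↑ʳ i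

data WheelEdge (n : ℕ) : Fin (n + n) → Set where
  rimEdge : ∀ i → WheelEdge n (rim {n} i)
  spokeEdge : ∀ i → WheelEdge n (spoke {n} i)

wheelEdge : ∀ n e → WheelEdge n e
wheelEdge n e with splitAt n e | join-splitAt n n e
... | inj₁ i | refl = rimEdge i
... | inj₂ i | refl = spokeEdge i

rim≢spoke : ∀ {n} {i j : Fin n} → rim i ≢ spoke j
rim≢spoke {n} {i} {j} rim≡spoke
  with trans (sym (splitAt-↑ˡ n i n)) (trans (cong (splitAt n) rim≡spoke) (splitAt-↑ʳ n n j))
... | ()

ends-rim : ∀ {n} (i : Fin n) → wheelEnds n (rim i) ≡ (suc i , suc (next i))
ends-rim {n} i rewrite splitAt-↑ˡ n i n = refl

ends-spoke : ∀ {n} (i : Fin n) → wheelEnds n (spoke i) ≡ (zero , suc i)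
ends-spoke {n} i rewrite splitAt-↑ʳ n n i = refl

isRim-rim : ∀ {n} (i : Fin n) → isRim n (rim i) ≡ true
isRim-rim {n} i rewrite splitAt-↑ˡ n i n = refl

isRim-spoke : ∀ {n} (i : Fin n) → isRim n (spoke i) ≡ false
isRim-spoke {n} i rewrite splitAt-↑ʳ n n i = refl

rim∈Rim : ∀ {n} (i : Fin n) → rim i ∈ Rim n
rim∈Rim {n} i = lookup⇒[]= (rim i) (Rim n) (trans (lookup∘tabulate (isRim n) (rim i)) (isRim-rim i))

spoke∉Rim : ∀ {n} (i : Fin n) → spoke i ∉ Rim n
spoke∉Rim {n} i spoke∈Rim
  with trans (sym (isRim-spoke i)) (trans (sym (lookup∘tabulate (isRim n) (spoke i))) ([]=⇒lookup spoke∈Rim))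
... | ()

Joins-rim : ∀ {n} {i : Fin n} {u w} → Joins (Wheel n) (rim i) u w →
  (u ≡ suc i × w ≡ suc (next i)) ⊎ (u ≡ suc (next i) × w ≡ suc i)
Joins-rim {i = i} (inj₁ ends≡uw) with trans (sym (ends-rim i)) ends≡uw
... | refl = inj₁ (refl , refl)
Joins-rim {i = i} (inj₂ ends≡wu) with trans (sym (ends-rim i)) ends≡wu
... | refl = inj₂ (refl , refl)

Joins-spoke : ∀ {n} {i : Fin n} {u w} → Joins (Wheel n) (spoke i) u w →
  (u ≡ zero × w ≡ suc i) ⊎ (u ≡ suc i × w ≡ zero)
Joins-spoke {i = i} (inj₁ ends≡uw) with trans (sym (ends-spoke i)) ends≡uw
... | refl = inj₁ (refl , refl)
Joins-spoke {i = i} (inj₂ ends≡wu) with trans (sym (ends-spoke i)) ends≡wu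
... | refl = inj₂ (refl , refl)

rim-cycle : ∀ {m X} → (∀ i → rim i ∈ X) → Cycle (Wheel (suc m)) X
rim-cycle {m} rims∈X = record
  { len = m ; verts = suc ; edges = rim ; vinj = fsuc-injective
  ; einj = λ {i} {j} → ↑ˡ-injective (suc m) i j ; inX = rims∈X
  ; joins = λ i → inj₁ (ends-rim i) }

forest⇒Rim⊈ : ∀ {m X} → Forest (Wheel (suc m)) X → ¬ Rim (suc m) ⊆ X
forest⇒Rim⊈ X-forest Rim⊆X = X-forest (rim-cycle (λ i → Rim⊆X (rim∈Rim i)))

∣X∣≡∣rims∣+∣spokes∣ : ∀ {n} (X : Subset (n + n)) → ∣ X ∣ ≡ ∣ preimage (rim {n}) X ∣ + ∣ preimage (spoke {n}) X ∣
∣X∣≡∣rims∣+∣spokes∣ {n} = ∣p∣≡∣p↑ˡ∣+∣p↑ʳ∣ n {n}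

∣Rim∣≡n : ∀ n → ∣ Rim n ∣ ≡ n
∣Rim∣≡n n = begin
  ∣ Rim n ∣
    ≡⟨ ∣X∣≡∣rims∣+∣spokes∣ {n} (Rim n) ⟩
  ∣ preimage (rim {n}) (Rim n) ∣ + ∣ preimage (spoke {n}) (Rim n) ∣
    ≡⟨ cong₂ (λ (p q : Subset n) → ∣ p ∣ + ∣ q ∣) rims≡⊤ spokes≡⊥ ⟩
  ∣ ⊤ {n} ∣ + ∣ ⊥ {n} ∣
    ≡⟨ cong₂ _+_ (∣⊤∣≡n n) (∣⊥∣≡0 n) ⟩
  n + 0
    ≡⟨ +-identityʳ n ⟩
  n ∎
  where
  open ≡-Reasoning
  rims≡⊤ : preimage (rim {n}) (Rim n) ≡ ⊤
  rims≡⊤ = ⊆-antisym ⊆⊤ (λ {i} _ → ∈-preimage⁺ (rim∈Rim i))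
  spokes≡⊥ : preimage (spoke {n}) (Rim n) ≡ ⊥
  spokes≡⊥ = Empty-unique λ (i , i∈) → spoke∉Rim i (∈-preimage⁻ {f = spoke} i∈)

-- Rotations of the wheel

turn : ∀ {n} → (Fin n → Fin n) → Fin (n + n) → Fin (n + n)
turn {n} σ e = [ rim ∘ σ , spoke ∘ σ ]′ (splitAt n e)

turn-rim : ∀ {n} (σ : Fin n → Fin n) i → turn σ (rim i) ≡ rim (σ i)
turn-rim {n} σ i = cong [ rim ∘ σ , spoke ∘ σ ]′ (splitAt-↑ˡ n i n)

turn-spoke : ∀ {n} (σ : Fin n → Fin n) i → turn σ (spoke i) ≡ spoke (σ i)
turn-spoke {n} σ i = cong [ rim ∘ σ , spoke ∘ σ ]′ (splitAt-↑ʳ n n i)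

turn-inverse : ∀ {n} {σ τ : Fin n → Fin n} → (∀ i → σ (τ i) ≡ i) → ∀ e → turn σ (turn τ e) ≡ e
turn-inverse {n} {σ} {τ} στ≡id e with wheelEdge n e
... | rimEdge i = trans (cong (turn σ) (turn-rim τ i)) (trans (turn-rim σ (τ i)) (cong rim (στ≡id i)))
... | spokeEdge i = trans (cong (turn σ) (turn-spoke τ i)) (trans (turn-spoke σ (τ i)) (cong spoke (στ≡id i)))

turn-injective : ∀ {n} {σ : Fin n → Fin n} → Injective _≡_ _≡_ σ → Injective _≡_ _≡_ (turn σ)
turn-injective {n} {σ} σ-inj {e} {e′} eq with wheelEdge n e | wheelEdge n e′
... | rimEdge i | rimEdge j =
  cong rim (σ-inj (↑ˡ-injective n _ _ (trans (sym (turn-rim σ i)) (trans eq (turn-rim σ j)))))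
... | spokeEdge i | spokeEdge j =
  cong spoke (σ-inj (↑ʳ-injective n _ _ (trans (sym (turn-spoke σ i)) (trans eq (turn-spoke σ j)))))
... | rimEdge i | spokeEdge j = contradiction (trans (sym (turn-rim σ i)) (trans eq (turn-spoke σ j))) rim≢spoke
... | spokeEdge i | rimEdge j = contradiction (trans (sym (turn-rim σ j)) (trans (sym eq) (turn-spoke σ i))) rim≢spoke

rotation : ∀ {m} (t : ℕ) → Embedding (Wheel (suc m)) (Wheel (suc m))
rotation {m} t = record
  { vmap = vmap ; emap = turn σ
  ; vmap-injective = vmap-injective ; emap-injective = turn-injective (next^-injective t)
  ; preserves-Joins = λ {e} → preserves-Joins {e} }
  where
  n : ℕ
  n = suc m
  W : Graph
  W = Wheel n
  σ : Fin n → Fin n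
  σ = next^ t
  vmap : Fin (suc n) → Fin (suc n)
  vmap zero = zero
  vmap (suc v) = suc (σ v)
  vmap-injective : Injective _≡_ _≡_ vmap
  vmap-injective {zero} {zero} _ = refl
  vmap-injective {suc v} {suc w} eq = cong suc (next^-injective t (fsuc-injective eq))
  rim-Joins : ∀ i → Joins W (rim {n} (σ i)) (vmap (suc i)) (vmap (suc (next i)))
  rim-Joins i = inj₁ (trans (ends-rim (σ i)) (cong (λ v → suc (σ i) , suc v) (sym (next^-next t i))))
  preserves-Joins : ∀ {e u w} → Joins W e u w → Joins W (turn σ e) (vmap u) (vmap w)
  preserves-Joins {e} {u} {w} joins with wheelEdge n e
  ... | rimEdge i = subst (λ e → Joins W e (vmap u) (vmap w)) (sym (turn-rim σ i)) (rotated (Joins-rim joins))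
    where
    rotated : (u ≡ suc i × w ≡ suc (next i)) ⊎ (u ≡ suc (next i) × w ≡ suc i) →
      Joins W (rim (σ i)) (vmap u) (vmap w)
    rotated (inj₁ (refl , refl)) = rim-Joins i
    rotated (inj₂ (refl , refl)) = Joins-sym W {rim (σ i)} (rim-Joins i)
  ... | spokeEdge i = subst (λ e → Joins W e (vmap u) (vmap w)) (sym (turn-spoke σ i)) (rotated (Joins-spoke joins))
    where
    rotated : (u ≡ zero × w ≡ suc i) ⊎ (u ≡ suc i × w ≡ zero) →
      Joins W (spoke (σ i)) (vmap u) (vmap w)
    rotated (inj₁ (refl , refl)) = inj₁ (ends-spoke (σ i))
    rotated (inj₂ (refl , refl)) = inj₂ (ends-spoke (σ i))

-- Spanning paths

spanningPath : ∀ {n} → Fin n → Fin n → Subset (n + n)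
spanningPath {n} k j = (Rim n - rim k) ∪ ⁅ spoke j ⁆

rim∈spanningPath⇒≢ : ∀ {n} {i k j : Fin n} → rim i ∈ spanningPath k j → i ≢ k
rim∈spanningPath⇒≢ {n} {i} {k} {j} rim∈ with x∈p∪q⁻ (Rim n - rim k) ⁅ spoke j ⁆ rim∈
... | inj₁ rim∈Rim-k = x∈p-y⇒x≢y rim∈Rim-k ∘ cong rim
... | inj₂ rim∈⁅spoke⁆ = contradiction (x∈⁅y⁆⇒x≡y (spoke j) rim∈⁅spoke⁆) rim≢spoke

spoke∈spanningPath⇒≡ : ∀ {n} {i k j : Fin n} → spoke i ∈ spanningPath k j → i ≡ j
spoke∈spanningPath⇒≡ {n} {i} {k} {j} spoke∈ with x∈p∪q⁻ (Rim n - rim k) ⁅ spoke j ⁆ spoke∈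
... | inj₁ spoke∈Rim-k = contradiction (x∈p-y⇒x∈p spoke∈Rim-k) (spoke∉Rim i)
... | inj₂ spoke∈⁅spoke⁆ = ↑ʳ-injective n i j (x∈⁅y⁆⇒x≡y (spoke j) spoke∈⁅spoke⁆)

rim∈spanningPath : ∀ {n} {i k : Fin n} j → i ≢ k → rim i ∈ spanningPath k j
rim∈spanningPath {n} {i} j i≢k = x∈p∪q⁺ (inj₁ (x∈p∧x≢y⇒x∈p-y (rim∈Rim i) (i≢k ∘ ↑ˡ-injective n _ _)))

spoke∈spanningPath : ∀ {n} (k j : Fin n) → spoke j ∈ spanningPath k j
spoke∈spanningPath {n} k j = x∈p∪q⁺ (inj₂ (x∈⁅x⁆ (spoke j)))

last-spanningPath-forest : ∀ {m} (j : Fin (suc m)) → Forest (Wheel (suc m)) (spanningPath (fromℕ m) j)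
last-spanningPath-forest {m} j = forest-from-potential W h up separates ascent-is-up
  where
  W : Graph
  W = Wheel (suc m)
  X : Subset (suc m + suc m)
  X = spanningPath (fromℕ m) j
  h : Fin (suc (suc m)) → ℕ
  h zero = 0
  h (suc v) = suc (toℕ v)
  up : Fin (suc (suc m)) → Fin (suc m + suc m)
  up zero = spoke j
  up (suc v) = rim v
  rim-climbs : ∀ {i} → rim i ∈ X → h (suc (next i)) ≡ suc (h (suc i))
  rim-climbs rim∈X = cong suc (toℕ-next-< (≢fromℕ⇒toℕ< (rim∈spanningPath⇒≢ rim∈X)))
  separates : ∀ {e u w} → e ∈ X → Joins W e u w → h u ≢ h w
  separates {e} e∈X joins with wheelEdge (suc m) e
  ... | rimEdge i with Joins-rim {i = i} joins
  ...   | inj₁ (refl , refl) = λ eq → 1+n≢n (sym (trans eq (rim-climbs e∈X)))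
  ...   | inj₂ (refl , refl) = λ eq → 1+n≢n (sym (trans (sym eq) (rim-climbs e∈X)))
  separates {e} e∈X joins | spokeEdge i with Joins-spoke {i = i} joins
  ...   | inj₁ (refl , refl) = λ ()
  ...   | inj₂ (refl , refl) = λ ()
  ascent-is-up : ∀ {e u w} → e ∈ X → Joins W e u w → h u < h w → e ≡ up u
  ascent-is-up {e} e∈X joins climbs with wheelEdge (suc m) e
  ... | rimEdge i with Joins-rim {i = i} joins
  ...   | inj₁ (refl , refl) = refl
  ...   | inj₂ (refl , refl) = contradiction (subst (h (suc i) <_) (sym (rim-climbs e∈X)) (n<1+n _)) (<-asym climbs)
  ascent-is-up {e} e∈X joins climbs | spokeEdge i with Joins-spoke {i = i} joins
  ...   | inj₁ (refl , refl) = cong spoke (spoke∈spanningPath⇒≡ e∈X)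
  ...   | inj₂ (refl , refl) = contradiction climbs λ ()

spanningPath-forest : ∀ {m} (k j : Fin (suc m)) → Forest (Wheel (suc m)) (spanningPath k j)
spanningPath-forest {m} k j with next^-reaches k (fromℕ m)
... | t , k↦last = forest-pullback (rotation t) ρ[path]⊆path (last-spanningPath-forest (next^ t j))
  where
  ρ[path]⊆path : ∀ {e} → e ∈ spanningPath k j → turn {suc m} (next^ t) e ∈ spanningPath (fromℕ m) (next^ t j)
  ρ[path]⊆path {e} e∈ with wheelEdge (suc m) e
  ... | rimEdge i = subst (_∈ _) (sym (turn-rim (next^ t) i))
          (rim∈spanningPath _ (rim∈spanningPath⇒≢ e∈ ∘ next^-injective t ∘ λ eq → trans eq (sym k↦last)))
  ... | spokeEdge i = subst (_∈ _) (sym (turn-spoke (next^ t) i))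
          (subst (λ i → spoke (next^ t i) ∈ _) (sym (spoke∈spanningPath⇒≡ e∈)) (spoke∈spanningPath _ _))

Rim-e+f-forest : ∀ {m e f} → e ∈ Rim (suc m) → f ∉ Rim (suc m) → Forest (Wheel (suc m)) ((Rim (suc m) - e) ∪ ⁅ f ⁆)
Rim-e+f-forest {m} {e} {f} e∈Rim f∉Rim with wheelEdge (suc m) e | wheelEdge (suc m) f
... | rimEdge k | spokeEdge j = spanningPath-forest k j
... | spokeEdge k | _ = contradiction e∈Rim (spoke∉Rim k)
... | rimEdge _ | rimEdge j = contradiction (rim∈Rim j) f∉Rim

-- Forests of the wheel have at most n edges

bit : Bool → ℕ
bit true = 1
bit false = 0

bit≤1 : ∀ b → bit b ≤ 1
bit≤1 true = ≤-refl
bit≤1 false = z≤n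

sum< : ℕ → (ℕ → ℕ) → ℕ
sum< zero f = 0
sum< (suc k) f = sum< k f + f k

sum<-suc : ∀ k f → sum< (suc k) f ≡ f 0 + sum< k (f ∘ suc)
sum<-suc zero f = sym (+-identityʳ (f 0))
sum<-suc (suc k) f = trans (cong (_+ f (suc k)) (sum<-suc k f)) (+-assoc (f 0) _ _)

bit-segment : ∀ σ ρ φ → ¬ (σ ≡ true × ρ ≡ true × φ ≡ true) → bit φ + (bit σ + bit ρ) ≤ suc (bit (σ ∨ (ρ ∧ φ)))
bit-segment false false false _ = z≤n
bit-segment false false true _ = s≤s z≤n
bit-segment true false false _ = s≤s z≤n
bit-segment true false true _ = ≤-refl
bit-segment false true false _ = ≤-refl
bit-segment false true true _ = ≤-refl
bit-segment true true false _ = ≤-refl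
bit-segment true true true not-all = contradiction (refl , refl , refl) not-all

-- Rim positions 0 … M: s t records the spoke at t, r t the rim edge from t to t + 1;
-- spokeBehind t says that the run of rim edges ending at t reaches a spoke.
module Segments (s r : ℕ → Bool) (M : ℕ) where

  NoFan : Set
  NoFan = ∀ i d → i + suc d ≤ M →
    ¬ (s i ≡ true × s (i + suc d) ≡ true × (∀ u → u ≤ d → r (i + u) ≡ true))

  spokeBehind : ℕ → Bool
  spokeBehind zero = s 0
  spokeBehind (suc t) = s (suc t) ∨ (r t ∧ spokeBehind t)

  spokeBehind-witness : ∀ t → spokeBehind t ≡ true →
    ∃ λ i → i ≤ t × s i ≡ true × (∀ u → i ≤ u → u < t → r u ≡ true)
  spokeBehind-witness zero s0 = 0 , z≤n , s0 , λ _ _ ()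
  spokeBehind-witness (suc t) _ with s (suc t) in s[1+t] | r t in r[t] | spokeBehind t in behind
  ... | true | _ | _ = suc t , ≤-refl , s[1+t] , λ u 1+t≤u u<1+t → contradiction u<1+t (≤⇒≯ 1+t≤u)
  ... | false | true | true =
    let i , i≤t , s[i] , run = spokeBehind-witness t behind
    in i , m≤n⇒m≤1+n i≤t , s[i] , λ u i≤u u<1+t →
         [ run u i≤u , (λ { refl → r[t] }) ]′ (m≤n⇒m<n∨m≡n (s≤s⁻¹ u<1+t))
  spokeBehind-witness (suc t) () | false | false | _
  spokeBehind-witness (suc t) () | false | true | false

  no-fan-ending-at : NoFan → ∀ t → suc t ≤ M → ¬ (s (suc t) ≡ true × r t ≡ true × spokeBehind t ≡ true)
  no-fan-ending-at no-fan t 1+t≤M (s[1+t] , r[t] , behind) =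
    let i , i≤t , s[i] , run = spokeBehind-witness t behind
        i+[1+t∸i]≡1+t : i + suc (t ∸ i) ≡ suc t
        i+[1+t∸i]≡1+t = trans (+-suc i (t ∸ i)) (cong suc (m+[n∸m]≡n i≤t))
        run′ : ∀ u → u ≤ t ∸ i → r (i + u) ≡ true
        run′ u u≤t∸i = [ run (i + u) (m≤m+n i u) , (λ i+u≡t → subst (λ v → r v ≡ true) (sym i+u≡t) r[t]) ]′
          (m≤n⇒m<n∨m≡n (subst (i + u ≤_) (m+[n∸m]≡n i≤t) (+-monoʳ-≤ i u≤t∸i)))
    in no-fan i (t ∸ i) (subst (_≤ M) (sym i+[1+t∸i]≡1+t) 1+t≤M)
         (s[i] , subst (λ v → s v ≡ true) (sym i+[1+t∸i]≡1+t) s[1+t] , run′)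

  count : ℕ → ℕ
  count t = sum< (suc t) (bit ∘ s) + sum< t (bit ∘ r)

  count-bound : NoFan → ∀ t → t ≤ M → count t ≤ t + bit (spokeBehind t)
  count-bound _ zero _ = ≤-reflexive (+-identityʳ (bit (s 0)))
  count-bound no-fan (suc t) 1+t≤M = begin
    count (suc t)                 ≡⟨ interchange (sum< (suc t) (bit ∘ s)) (bit σ) (sum< t (bit ∘ r)) (bit ρ) ⟩
    count t + (bit σ + bit ρ)     ≤⟨ +-monoˡ-≤ (bit σ + bit ρ) (count-bound no-fan t (<⇒≤ 1+t≤M)) ⟩
    t + bit φ + (bit σ + bit ρ)   ≡⟨ +-assoc t (bit φ) (bit σ + bit ρ) ⟩
    t + (bit φ + (bit σ + bit ρ)) ≤⟨ +-monoʳ-≤ t (bit-segment σ ρ φ (no-fan-ending-at no-fan t 1+t≤M)) ⟩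
    t + suc (bit (σ ∨ (ρ ∧ φ)))   ≡⟨ +-suc t _ ⟩
    suc t + bit (spokeBehind (suc t)) ∎
    where
    open ≤-Reasoning
    σ ρ φ : Bool
    σ = s (suc t)
    ρ = r t
    φ = spokeBehind t

  segments-bound : NoFan → sum< (suc M) (bit ∘ s) + sum< M (bit ∘ r) ≤ suc M
  segments-bound no-fan = ≤-trans (count-bound no-fan M ≤-refl) (begin
    M + bit (spokeBehind M) ≤⟨ +-monoʳ-≤ M (bit≤1 (spokeBehind M)) ⟩
    M + 1                   ≡⟨ +-comm M 1 ⟩
    suc M                   ∎)
    where open ≤-Reasoning

-- The cycle hub, i, i + 1, …, i + d + 1, hub through two spokes and a run of rim edges.
module FanCycle {m} (Y : Subset (suc m + suc m)) (i d : ℕ) (i+1+d≤m : i + suc d ≤ m)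
  (first-spoke : spoke {suc m} (pos i) ∈ Y) (last-spoke : spoke {suc m} (pos (i + suc d)) ∈ Y)
  (run : ∀ u → u ≤ d → rim {suc m} (pos (i + u)) ∈ Y) where

  n : ℕ
  n = suc m
  len : ℕ
  len = suc (suc d)

  i+u≤m : ∀ {u} → u ≤ suc d → i + u ≤ m
  i+u≤m u≤1+d = ≤-trans (+-monoʳ-≤ i u≤1+d) i+1+d≤m

  pos-injective : ∀ {u u′} → u ≤ suc d → u′ ≤ suc d → pos {m} (i + u) ≡ pos (i + u′) → u ≡ u′
  pos-injective {u} {u′} u≤ u′≤ eq =
    +-cancelˡ-≡ i u u′ (trans (sym (toℕ-pos (i+u≤m u≤))) (trans (cong toℕ eq) (toℕ-pos (i+u≤m u′≤))))

  V : ℕ → Fin (suc n)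
  V zero = zero
  V (suc u) = suc (pos (i + u))

  E′ : ∀ u → Dec (u ≤ d) → Fin (n + n)
  E′ u (yes _) = rim (pos (i + u))
  E′ u (no _) = spoke (pos (i + suc d))

  E : ℕ → Fin (n + n)
  E zero = spoke (pos i)
  E (suc u) = E′ u (u ≤? d)

  V-injective : ∀ {t t′} → t ≤ len → t′ ≤ len → V t ≡ V t′ → t ≡ t′
  V-injective {zero} {zero} _ _ _ = refl
  V-injective {suc u} {suc u′} t≤ t′≤ eq = cong suc (pos-injective (s≤s⁻¹ t≤) (s≤s⁻¹ t′≤) (fsuc-injective eq))

  first≢last : pos {m} i ≢ pos (i + suc d)
  first≢last eq = contradiction (pos-injective z≤n ≤-refl (trans (cong pos (+-identityʳ i)) eq)) (λ ())

  E-injective : ∀ {t t′} → t ≤ len → t′ ≤ len → E t ≡ E t′ → t ≡ t′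
  E-injective {zero} {zero} _ _ _ = refl
  E-injective {zero} {suc u′} _ _ eq with u′ ≤? d
  ... | yes _ = contradiction (sym eq) rim≢spoke
  ... | no _ = contradiction (↑ʳ-injective n _ _ eq) first≢last
  E-injective {suc u} {zero} _ _ eq with u ≤? d
  ... | yes _ = contradiction eq rim≢spoke
  ... | no _ = contradiction (↑ʳ-injective n _ _ (sym eq)) first≢last
  E-injective {suc u} {suc u′} t≤ t′≤ eq with u ≤? d | u′ ≤? d
  ... | yes u≤d | yes u′≤d = cong suc (pos-injective (m≤n⇒m≤1+n u≤d) (m≤n⇒m≤1+n u′≤d) (↑ˡ-injective n _ _ eq))
  ... | yes _ | no _ = contradiction eq rim≢spoke
  ... | no _ | yes _ = contradiction (sym eq) rim≢spoke
  ... | no u≰d | no u′≰d =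
    cong suc (trans (≤-antisym (s≤s⁻¹ t≤) (≰⇒> u≰d)) (sym (≤-antisym (s≤s⁻¹ t′≤) (≰⇒> u′≰d))))

  step-Joins : ∀ t → t < len → Joins (Wheel n) (E t) (V t) (V (suc t))
  step-Joins zero _ = inj₁ (trans (ends-spoke (pos i)) (cong (λ v → zero , suc (pos v)) (sym (+-identityʳ i))))
  step-Joins (suc u) 1+u<len with u ≤? d
  ... | yes u≤d = inj₁ (trans (ends-rim (pos (i + u)))
          (cong (λ v → suc (pos (i + u)) , suc v) (trans (next-pos i+u<m) (cong pos (sym (+-suc i u))))))
    where
    i+u<m : i + u < m
    i+u<m = <-≤-trans (+-monoʳ-< i (s≤s u≤d)) i+1+d≤m
  ... | no u≰d = contradiction (s≤s⁻¹ (s≤s⁻¹ 1+u<len)) u≰d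

  closing-Joins : Joins (Wheel n) (E len) (V len) (V 0)
  closing-Joins with suc d ≤? d
  ... | yes 1+d≤d = contradiction 1+d≤d (n≮n d)
  ... | no _ = inj₂ (ends-spoke (pos (i + suc d)))

  E∈Y : ∀ t → E t ∈ Y
  E∈Y zero = first-spoke
  E∈Y (suc u) with u ≤? d
  ... | yes u≤d = run u u≤d
  ... | no _ = last-spoke

  cycle : Cycle (Wheel n) Y
  cycle = record
    { len = len ; verts = V ∘ toℕ ; edges = E ∘ toℕ
    ; vinj = λ {x} {y} → toℕ-injective ∘ V-injective (toℕ≤len x) (toℕ≤len y)
    ; einj = λ {x} {y} → toℕ-injective ∘ E-injective (toℕ≤len x) (toℕ≤len y)
    ; inX = E∈Y ∘ toℕ ; joins = joins }
    where
    toℕ≤len : (x : Fin (suc len)) → toℕ x ≤ len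
    toℕ≤len x = s≤s⁻¹ (toℕ<n x)
    joins : ∀ x → Joins (Wheel n) (E (toℕ x)) (V (toℕ x)) (V (toℕ (next x)))
    joins x with toℕ-next {len} x
    ... | inj₁ (x≡len , next≡0) = subst (λ y → Joins (Wheel n) (E (toℕ x)) (V (toℕ x)) (V (toℕ y))) (sym next≡0)
            (subst (λ t → Joins (Wheel n) (E t) (V t) (V 0)) (sym x≡len) closing-Joins)
    ... | inj₂ (x<len , toℕ-next≡) = subst (Joins (Wheel n) (E (toℕ x)) (V (toℕ x)) ∘ V) (sym toℕ-next≡)
            (step-Joins (toℕ x) x<len)

at : ∀ {n} → Subset n → ℕ → Bool
at [] _ = false
at (b ∷ p) zero = b
at (b ∷ p) (suc t) = at p t

at-toℕ : ∀ {n} (p : Subset n) i → at p (toℕ i) ≡ lookup p i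
at-toℕ (b ∷ p) zero = refl
at-toℕ (b ∷ p) (suc i) = at-toℕ p i

∣p∣≡sum<bit∘at : ∀ {n} (p : Subset n) → ∣ p ∣ ≡ sum< n (bit ∘ at p)
∣p∣≡sum<bit∘at [] = refl
∣p∣≡sum<bit∘at {suc n} (b ∷ p) = begin
  ∣ b ∷ p ∣                         ≡⟨ ∣b∷p∣≡bit+∣p∣ b ⟩
  bit b + ∣ p ∣                     ≡⟨ cong (bit b +_) (∣p∣≡sum<bit∘at p) ⟩
  bit b + sum< n (bit ∘ at p)       ≡⟨ sum<-suc n (bit ∘ at (b ∷ p)) ⟨
  sum< (suc n) (bit ∘ at (b ∷ p))   ∎
  where
  open ≡-Reasoning
  ∣b∷p∣≡bit+∣p∣ : ∀ b → ∣ b ∷ p ∣ ≡ bit b + ∣ p ∣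
  ∣b∷p∣≡bit+∣p∣ true = refl
  ∣b∷p∣≡bit+∣p∣ false = refl

at-pos : ∀ {m} (p : Subset (suc m)) {t} → t ≤ m → at p t ≡ lookup p (pos t)
at-pos p {t} t≤m = trans (cong (at p) (sym (toℕ-pos t≤m))) (at-toℕ p (pos t))

at-preimage⇒∈ : ∀ {m} {Y : Subset (suc m + suc m)} (f : Fin (suc m) → Fin (suc m + suc m)) {t} → t ≤ m →
  at (preimage f Y) t ≡ true → f (pos t) ∈ Y
at-preimage⇒∈ {Y = Y} f t≤m at≡true =
  ∈-preimage⁻ {f = f} (lookup⇒[]= _ (preimage f Y) (trans (sym (at-pos (preimage f Y) t≤m)) at≡true))

last-rim-free-forest-rank : ∀ {m} {Y} → Forest (Wheel (suc m)) Y → rim (fromℕ m) ∉ Y → ∣ Y ∣ ≤ suc m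
last-rim-free-forest-rank {m} {Y} Y-forest last∉Y = begin
  ∣ Y ∣                                           ≡⟨ ∣X∣≡∣rims∣+∣spokes∣ {n} Y ⟩
  ∣ R ∣ + ∣ S ∣                                   ≡⟨ cong₂ _+_ (∣p∣≡sum<bit∘at R) (∣p∣≡sum<bit∘at S) ⟩
  sum< m (bit ∘ r) + bit (r m) + sum< n (bit ∘ s) ≡⟨ cong (λ b → Σr + bit b + Σs) r[m]≡false ⟩
  sum< m (bit ∘ r) + 0 + sum< n (bit ∘ s)         ≡⟨ cong (_+ Σs) (+-identityʳ Σr) ⟩
  sum< m (bit ∘ r) + sum< n (bit ∘ s)             ≡⟨ +-comm Σr Σs ⟩
  sum< n (bit ∘ s) + sum< m (bit ∘ r)             ≤⟨ Segments.segments-bound s r m no-fan ⟩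
  suc m                                           ∎
  where
  open ≤-Reasoning
  n : ℕ
  n = suc m
  R S : Subset n
  R = preimage (rim {n}) Y
  S = preimage (spoke {n}) Y
  r s : ℕ → Bool
  r = at R
  s = at S
  Σr Σs : ℕ
  Σr = sum< m (bit ∘ r)
  Σs = sum< n (bit ∘ s)
  pos[m]≡last : pos m ≡ fromℕ m
  pos[m]≡last = toℕ-injective (trans (toℕ-pos ≤-refl) (sym (toℕ-fromℕ m)))
  r[m]≡false : r m ≡ false
  r[m]≡false = trans (at-pos R ≤-refl) (∉⇒lookup≡false λ pos[m]∈R →
    last∉Y (subst (λ v → rim v ∈ Y) pos[m]≡last (∈-preimage⁻ {f = rim} pos[m]∈R)))
  no-fan : Segments.NoFan s r m
  no-fan i d i+1+d≤m (s[i] , s[i+1+d] , run) = Y-forest (FanCycle.cycle Y i d i+1+d≤m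
    (at-preimage⇒∈ spoke (≤-trans (m≤m+n i (suc d)) i+1+d≤m) s[i])
    (at-preimage⇒∈ spoke i+1+d≤m s[i+1+d])
    (λ u u≤d → at-preimage⇒∈ rim (≤-trans (+-monoʳ-≤ i (m≤n⇒m≤1+n u≤d)) i+1+d≤m) (run u u≤d)))

wheel-forest-rank : ∀ {m} {I} → Forest (Wheel (suc m)) I → ∣ I ∣ ≤ suc m
wheel-forest-rank {m} {I} I-forest with ¬∀⟶∃¬ (suc m) (λ k → rim k ∈ I) (λ k → rim k ∈? I) (I-forest ∘ rim-cycle)
... | k , rim[k]∉I with next^-reaches (fromℕ m) k
...   | t , last↦k = begin
  ∣ I ∣ ≤⟨ injective⇒∣p∣≤∣q∣ {q = Y} (turn (prev^ t)) turn⁻¹-injective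
             (λ {e} e∈I → ∈-preimage⁺ {f = turn σ} (subst (_∈ I) (sym (round-trip e)) e∈I)) ⟩
  ∣ Y ∣ ≤⟨ last-rim-free-forest-rank Y-forest last∉Y ⟩
  suc m ∎
  where
  open ≤-Reasoning
  σ : Fin (suc m) → Fin (suc m)
  σ = next^ t
  Y : Subset (suc m + suc m)
  Y = preimage (turn σ) I
  round-trip : ∀ e → turn σ (turn (prev^ t) e) ≡ e
  round-trip = turn-inverse (next^∘prev^ t)
  turn⁻¹-injective : Injective _≡_ _≡_ (turn {suc m} (prev^ t))
  turn⁻¹-injective {e} {e′} eq = trans (sym (round-trip e)) (trans (cong (turn σ) eq) (round-trip e′))
  Y-forest : Forest (Wheel (suc m)) Y
  Y-forest = forest-pullback (rotation t) (∈-preimage⁻ {f = turn σ}) I-forest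
  last∉Y : rim (fromℕ m) ∉ Y
  last∉Y last∈Y =
    rim[k]∉I (subst (_∈ I) (trans (turn-rim σ (fromℕ m)) (cong rim last↦k)) (∈-preimage⁻ {f = turn σ} last∈Y))

whirl-rank : ∀ {m X} → WhirlIndep (suc m) X → ∣ X ∣ ≤ suc m
whirl-rank (inj₁ X-forest) = wheel-forest-rank X-forest
whirl-rank {m} (inj₂ refl) = ≤-reflexive (∣Rim∣≡n (suc m))

-- Flats of the whirl

module Whirl (m : ℕ) where

  n : ℕ
  n = suc m

  Rim-e-flat : ∀ {e} → e ∈ Rim n → IsFlat (WhirlIndep n) (Rim n - e)
  Rim-e-flat {e} e∈Rim f f∉Rim-e = independent-extension-raises-rank f∉Rim-e independent
    where
    independent : WhirlIndep n ((Rim n - e) ∪ ⁅ f ⁆)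
    independent with f ≟ᶠ e
    ... | yes refl = inj₂ (p-x∪⁅x⁆≡p e∈Rim)
    ... | no f≢e = inj₁ (Rim-e+f-forest e∈Rim (f∉Rim-e ∘ λ f∈Rim → x∈p∧x≢y⇒x∈p-y f∈Rim f≢e))

  graphic-flat⇒flat : ∀ {F} → IsFlat (GraphicIndep (Wheel n)) F → ¬ Rim n ⊆ F → IsFlat (WhirlIndep n) F
  graphic-flat⇒flat F-flat Rim⊈F e e∉F =
    let I , I⊆F+e , I-forest , I-beats = F-flat e e∉F
    in I , I⊆F+e , inj₁ I-forest , λ where
      J J⊆F (inj₁ J-forest) → I-beats J J⊆F J-forest
      J J⊆F (inj₂ refl) → ⊥-elim (Rim⊈F J⊆F)

  L⇒flat : ∀ {F} → L₁ n F ⊎ L₂ n F → IsFlat (WhirlIndep n) F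
  L⇒flat (inj₁ (e , e∈Rim , refl)) = Rim-e-flat e∈Rim
  L⇒flat (inj₂ (inj₁ refl)) = ⊤-flat (WhirlIndep n)
  L⇒flat (inj₂ (inj₂ (F-flat , Rim⊈F))) = graphic-flat⇒flat F-flat Rim⊈F

  L₁∩L₂≡∅ : ∀ F → ¬ (L₁ n F × L₂ n F)
  L₁∩L₂≡∅ F ((e , e∈Rim , refl) , inj₁ Rim-e≡⊤) = x∉p-x (Rim n) e (subst (e ∈_) (sym Rim-e≡⊤) ∈⊤)
  L₁∩L₂≡∅ F ((e , e∈Rim , refl) , inj₂ (F-flat , _)) with F-flat e (x∉p-x (Rim n) e)
  ... | I , I⊆Rim-e+e , I-forest , I-beats = <⇒≱ ∣Rim-e∣<∣I∣ ∣I∣≤∣Rim-e∣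
    where
    ∣Rim-e∣<∣I∣ : ∣ Rim n - e ∣ < ∣ I ∣
    ∣Rim-e∣<∣I∣ = I-beats (Rim n - e) id
      (forest-antitone (Wheel n) (p⊆p∪q ⁅ spoke zero ⁆) (Rim-e+f-forest e∈Rim (spoke∉Rim zero)))
    I⊆Rim : I ⊆ Rim n
    I⊆Rim = subst (I ⊆_) (p-x∪⁅x⁆≡p e∈Rim) I⊆Rim-e+e
    ∣I∣≤∣Rim-e∣ : ∣ I ∣ ≤ ∣ Rim n - e ∣
    ∣I∣≤∣Rim-e∣ =
      s≤s⁻¹ (subst (∣ I ∣ <_) (∣p∣≡1+∣p-x∣ e∈Rim) (p⊆q∧q⊈p⇒∣p∣<∣q∣ I⊆Rim (forest⇒Rim⊈ I-forest)))

  Rim⊆flat⇒⊤ : ∀ {F} → IsFlat (WhirlIndep n) F → Rim n ⊆ F → F ≡ ⊤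
  Rim⊆flat⇒⊤ {F} F-flat Rim⊆F with ⊤ ⊆? F
  ... | yes ⊤⊆F = ⊆-antisym ⊆⊤ ⊤⊆F
  ... | no ⊤⊈F with p⊈q⇒∃∈p∉q ⊤⊈F
  ...   | e , _ , e∉F with F-flat e e∉F
  ...     | I , _ , I-independent , I-beats =
    ⊥-elim (<⇒≱ (I-beats (Rim n) Rim⊆F (inj₂ refl))
                (≤-trans (whirl-rank I-independent) (≤-reflexive (sym (∣Rim∣≡n n)))))

  -- Unless F = Rim − e, some forest (Rim − e) ∪ {s} inside F is as large as the rim.
  Rim-cannot-raise-rank : ∀ {F e} → ¬ L₁ n F → ¬ Rim n ⊆ F → e ∉ F → Rim n ⊆ F ∪ ⁅ e ⁆ →
    ¬ (∀ J → J ⊆ F → WhirlIndep n J → ∣ J ∣ < ∣ Rim n ∣)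
  Rim-cannot-raise-rank {F} {e} F∉L₁ Rim⊈F e∉F Rim⊆F+e Rim-beats with e ∈? Rim n
  ... | no e∉Rim = Rim⊈F (x∉p∧p⊆q∪⁅x⁆⇒p⊆q e∉Rim Rim⊆F+e)
  ... | yes e∈Rim with F ⊆? (Rim n - e)
  ...   | yes F⊆Rim-e = F∉L₁ (e , e∈Rim , ⊆-antisym F⊆Rim-e (p⊆q∪⁅x⁆⇒p-x⊆q Rim⊆F+e))
  ...   | no F⊈Rim-e with p⊈q⇒∃∈p∉q F⊈Rim-e
  ...     | s , s∈F , s∉Rim-e = <-irrefl ∣J∣≡∣Rim∣ (Rim-beats J J⊆F (inj₁ (Rim-e+f-forest e∈Rim s∉Rim)))
    where
    s∉Rim : s ∉ Rim n
    s∉Rim s∈Rim = s∉Rim-e (x∈p∧x≢y⇒x∈p-y s∈Rim λ { refl → e∉F s∈F })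
    J : Subset (n + n)
    J = (Rim n - e) ∪ ⁅ s ⁆
    J⊆F : J ⊆ F
    J⊆F = p⊆r∧x∈r⇒p∪⁅x⁆⊆r (p⊆q∪⁅x⁆⇒p-x⊆q Rim⊆F+e) s∈F
    ∣J∣≡∣Rim∣ : ∣ J ∣ ≡ ∣ Rim n ∣
    ∣J∣≡∣Rim∣ = trans (∣p∪⁅x⁆∣≡1+∣p∣ s∉Rim-e) (sym (∣p∣≡1+∣p-x∣ e∈Rim))

  L₁? : ∀ F → Dec (L₁ n F)
  L₁? F = any? λ e → e ∈? Rim n ×-dec ≡-decᵛ _≟ᵇ_ F (Rim n - e)

  flat⇒L : ∀ {F} → IsFlat (WhirlIndep n) F → L₁ n F ⊎ L₂ n F
  flat⇒L {F} F-flat with Rim n ⊆? F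
  ... | yes Rim⊆F = inj₂ (inj₁ (Rim⊆flat⇒⊤ F-flat Rim⊆F))
  ... | no Rim⊈F with L₁? F
  ...   | yes F∈L₁ = inj₁ F∈L₁
  ...   | no F∉L₁ = inj₂ (inj₂ (graphic-flat , Rim⊈F))
    where
    graphic-flat : IsFlat (GraphicIndep (Wheel n)) F
    graphic-flat e e∉F with F-flat e e∉F
    ... | I , I⊆F+e , inj₁ I-forest , I-beats =
      I , I⊆F+e , I-forest , λ J J⊆F J-forest → I-beats J J⊆F (inj₁ J-forest)
    ... | _ , Rim⊆F+e , inj₂ refl , Rim-beats = ⊥-elim (Rim-cannot-raise-rank F∉L₁ Rim⊈F e∉F Rim⊆F+e Rim-beats)

  flats : DisjointUnionOfFlats (WhirlIndep n) (L₁ n) (L₂ n)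
  flats = (λ F → flat⇒L) , (λ F → L⇒flat) , L₁∩L₂≡∅

lemma4p13 : DisjointUnionOfFlats W¹Indep L₁-W¹ L₂-W¹ ×
    DisjointUnionOfFlats W²Indep L₁-W² L₂-W² ×
    ((n : ℕ) → 3 ≤ n → DisjointUnionOfFlats (WhirlIndep n) (L₁ n) (L₂ n))
-- The whirl argument only needs n ≥ 1.
lemma4p13 = W¹-flats , W²-flats , λ { (suc m) _ → Whirl.flats m }
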